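{- For every temporal graph $(G,\lambda)$, the treewidth of the relational structure $\mathcal{A}_{G,\lambda}$ is at most $(2\Delta_{G,\lambda}+1)(\mathrm{tw}(G)+1)-1$, where $\mathrm{tw}(G)$ is the treewidth of $G$ and $\Delta_{G,\lambda}$ is the maximum temporal total degree of $(G,\lambda)$.
   Context: A temporal graph is a pair $(G,\lambda)$ where $G=(V,E)$ is a finite static graph and $\lambda: E\to 2^{\mathbb{N}}$ assigns to every edge a finite set of time labels. A time-edge is a pair $(e,t)$ with $e\in E$, $t\in\lambda(e)$; let $\mathcal{E}(G,\lambda)$ be the set of all time-edges. The temporal total degree of a vertex $v$ is the number of time-edges $(e,t)$ with $e$ incident to $v$; $\Delta_{G,\lambda}$ is its maximum over vertices. The relational structure $\mathcal{A}_{G,\lambda}$ has universe $V(G)\cup E(G)\cup\mathcal{E}(G,\lambda)$ and two binary relations: $\mathcal{R}$, where $((e_1,t_1),(e_2,t_2))\in\mathcal{R}$ iff $(e_1,t_1),(e_2,t_2)$ are time-edges, $e_1,e_2$ share a vertex in $G$, and $t_1<t_2$; and $\mathcal{L}$, where $(e,(e,t))\in\mathcal{L}$ iff $(e,t)$ is a time-edge. A tree decomposition of a relational structure with universe $A$ is a pair $(T,\mathcal{B})$ with $T$ a tree and $\mathcal{B}=\{\mathcal{B}_s\subseteq A: s\in V(T)\}$ such that for every $a\in A$ the set $\{s: a\in\mathcal{B}_s\}$ is nonempty and induces a connected subtree of $T$, and for every relation and every tuple $(a_1,\dots,a_r)$ in it there is $s$ with $a_1,\dots,a_r\in\mathcal{B}_s$.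 Its width is $\max_s|\mathcal{B}_s|-1$, and the treewidth of the structure is the minimum width of a tree decomposition. -}

module Defs where

open import Data.Nat using (ℕ; zero; suc; _+_; _*_; _≤_; _<_; _⊔_)
open import Data.Fin using (Fin; toℕ) renaming (zero to fzero; suc to fsuc)
open import Data.Fin.Properties using () renaming (_≟_ to _≟ᶠ_)
open import Data.List using (List; length; map; foldr; allFin)
open import Data.Nat.ListAction using (sum)
open import Data.List.Membership.Propositional using (_∈_)
open import Data.List.Relation.Unary.Unique.Propositional using (Unique)
open import Data.Product using (Σ; ∃; ∃-syntax; Σ-syntax; _×_; _,_; proj₁; proj₂)
open import Data.Sum using (_⊎_; inj₁; inj₂)
open import Data.Unit using (⊤; tt)
open import Data.Empty using (⊥)
open import Data.Bool using (Bool; true; false; if_then_else_)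
open import Relation.Nullary using (¬_)
open import Relation.Nullary.Decidable using (⌊_⌋; _⊎-dec_)
open import Relation.Binary.PropositionalEquality using (_≡_)

-- A (nonempty) finite tree on nodes Fin (suc k): node 0 is the root and
-- node (suc i) has a parent with a strictly smaller index.  Every finite
-- tree is isomorphic to one of this form (e.g. number nodes in BFS order).

record Tree : Set where
  field
    k         : ℕ
    parent    : Fin k → Fin (suc k)
    parent<   : (i : Fin k) → toℕ (parent i) ≤ toℕ i   -- parent of node (suc i) is < suc i

  Node : Set
  Node = Fin (suc k)

  Adj : Node → Node → Set
  Adj s s' = (∃[ i ] (s ≡ fsuc i × s' ≡ parent i)) ⊎ (∃[ i ] (s' ≡ fsuc i × s ≡ parent i))

  data WalkIn (P : Node → Set) : Node → Node → Set where
    here : ∀ {s} → P s → WalkIn P s s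
    step : ∀ {s s' s''} → P s → Adj s s' → WalkIn P s' s'' → WalkIn P s s''

  ConnectedIn : (Node → Set) → Set
  ConnectedIn P = ∀ s s' → P s → P s' → WalkIn P s s'

-- Relational structures with binary relations (all relations used here
-- are binary), and tree decompositions.

record Structure : Set₁ where
  field
    U   : Set
    Idx : Set
    rel : Idx → U → U → Set

record TreeDecomposition (S : Structure) : Set₁ where
  open Structure S
  field
    tree : Tree
  open Tree tree
  field
    bag       : Node → List U
    nonempty  : ∀ (a : U) → ∃[ s ] (a ∈ bag s)
    connected : ∀ (a : U) → ConnectedIn (λ s → a ∈ bag s)
    covers    : ∀ (r : Idx) (a b : U) → rel r a b → ∃[ s ] (a ∈ bag s × b ∈ bag s)

-- "tw(S) ≤ w - 1", i.e. S has a tree decomposition all of whose bags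
-- have at most w elements (width = max bag size - 1).
TwPlusOne≤ : Structure → ℕ → Set₁
TwPlusOne≤ S w = Σ[ T ∈ TreeDecomposition S ]
  (∀ s → length (TreeDecomposition.bag T s) ≤ w)

record Graph : Set where
  field
    n m        : ℕ
    ends       : Fin m → Fin n × Fin n
    loopless   : ∀ e → ¬ (proj₁ (ends e) ≡ proj₂ (ends e))
    noParallel : ∀ e e' → (ends e ≡ ends e' ⊎ (proj₁ (ends e) ≡ proj₂ (ends e') × proj₂ (ends e) ≡ proj₁ (ends e')))
                 → e ≡ e'

  Incident : Fin n → Fin m → Set
  Incident v e = (proj₁ (ends e) ≡ v) ⊎ (proj₂ (ends e) ≡ v)

  incident? : Fin n → Fin m → Bool
  incident? v e = ⌊ (proj₁ (ends e) ≟ᶠ v) ⊎-dec (proj₂ (ends e) ≟ᶠ v) ⌋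

  ShareVertex : Fin m → Fin m → Set
  ShareVertex e₁ e₂ = ∃[ v ] (Incident v e₁ × Incident v e₂)

graphStructure : Graph → Structure
graphStructure G = record
  { U = Fin n ; Idx = ⊤ ; rel = λ _ u v → ∃[ e ] (ends e ≡ (u , v)) }
  where open Graph G

-- Temporal graphs (G, λ): λ(e) is a finite set of naturals, represented
-- as a duplicate-free list.

record TemporalGraph : Set where
  field
    G         : Graph
  open Graph G public
  field
    lab       : Fin m → List ℕ
    labUnique : ∀ e → Unique (lab e)

  TimeEdge : Set
  TimeEdge = Σ[ e ∈ Fin m ] Σ[ t ∈ ℕ ] (t ∈ lab e)

  tdeg : Fin n → ℕ
  tdeg v = sum (map (λ e → if incident? v e then length (lab e) else 0) (allFin m))

  -- Δ_{G,λ}: maximum temporal total degree (0 if there are no vertices)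
  Δ : ℕ
  Δ = foldr _⊔_ 0 (map tdeg (allFin n))

  Univ : Set
  Univ = Fin n ⊎ (Fin m ⊎ TimeEdge)

  RelR : Univ → Univ → Set
  RelR (inj₂ (inj₂ (e₁ , t₁ , _))) (inj₂ (inj₂ (e₂ , t₂ , _))) = ShareVertex e₁ e₂ × t₁ < t₂
  RelR _ _ = ⊥

  RelL : Univ → Univ → Set
  RelL (inj₂ (inj₁ e)) (inj₂ (inj₂ (e' , t , _))) = e ≡ e'
  RelL _ _ = ⊥

𝓐 : TemporalGraph → Structure
𝓐 TG = record
  { U = Univ ; Idx = Bool
  ; rel = λ { true → RelR ; false → RelL } }
  where open TemporalGraph TG

-- Let (T, B) be a tree decomposition of G whose bags have at most w
-- vertices.  Every vertex v "owns" the elements of 𝓐 it is responsible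
-- for: v itself and, for every edge e incident to v, the block of e,
-- i.e. its time-edges and (if λ(e) ≠ ∅) e itself.  Replacing every vertex
-- of every bag by what it owns gives bags of size at most
-- (1 + 2·tdeg v)·w ≤ (2Δ+1)·w.  An element is owned by one vertex or by
-- the endpoints of one edge, and some bag contains all its owners, so
-- its occurrences form a union of subtrees through a common node, hence
-- a subtree.  The only elements owned by nobody are the edges with no
-- label; they are unrelated to everything and each gets a fresh leaf
-- attached to the root.

module Submission where

open import Defs
open import Data.Nat using (ℕ; suc; _+_; _*_; _≤_; z≤n; s≤s; _⊔_)
open import Data.Nat.Properties
open import Data.Fin using (Fin; toℕ; splitAt; _↑ˡ_; _↑ʳ_) renaming (zero to fzero)
open import Data.Fin.Properties using (toℕ-↑ˡ; splitAt-↑ˡ; splitAt-↑ʳ; splitAt⁻¹-↑ˡ; splitAt⁻¹-↑ʳ)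
open import Data.List using (List; []; _∷_; _++_; length; map; foldr; concatMap; allFin)
open import Data.List.Properties using (length-++; ≡-dec)
open import Data.Nat.ListAction using (sum)
open import Data.List.Membership.Propositional using (_∈_; _∉_; mapWith∈; find; lose)
open import Data.List.Membership.Propositional.Properties
  using (∈-++⁺ˡ; ∈-++⁺ʳ; ∈-++⁻; ∈-concatMap⁺; ∈-concatMap⁻; ∈-allFin; ∈-length)
open import Data.List.Membership.Setoid.Properties using (length-mapWith∈)
open import Data.List.Relation.Unary.Any using (here; there)
open import Data.List.Relation.Unary.Any.Properties using (mapWith∈⁺; mapWith∈⁻)
open import Data.Product using (∃-syntax; _×_; _,_; proj₁; proj₂)
open import Data.Sum using (_⊎_; inj₁; inj₂; [_,_]′)
open import Data.Unit using (tt)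
open import Data.Empty using (⊥; ⊥-elim)
open import Data.Bool using (Bool; true; false; if_then_else_; T)
open import Relation.Nullary using (yes; no)
open import Relation.Nullary.Decidable using (toWitness; fromWitness)
open import Relation.Binary.PropositionalEquality
  using (_≡_; _≢_; refl; sym; cong; subst; setoid)

length-concatMap-≤ : {A B : Set} (f : A → List B) (c : ℕ)
  → (∀ x → length (f x) ≤ c) → ∀ xs → length (concatMap f xs) ≤ length xs * c
length-concatMap-≤ f c bound [] = z≤n
length-concatMap-≤ f c bound (x ∷ xs) = begin
  length (f x ++ concatMap f xs)            ≡⟨ length-++ (f x) ⟩
  length (f x) + length (concatMap f xs)    ≤⟨ +-mono-≤ (bound x) (length-concatMap-≤ f c bound xs) ⟩
  c + length xs * c                         ∎
  where open ≤-Reasoning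

length-concatMap-≤-sum : {A B : Set} (f : A → List B) (c : ℕ) (k : A → ℕ)
  → (∀ x → length (f x) ≤ c * k x) → ∀ xs → length (concatMap f xs) ≤ c * sum (map k xs)
length-concatMap-≤-sum f c k bound [] = z≤n
length-concatMap-≤-sum f c k bound (x ∷ xs) = begin
  length (f x ++ concatMap f xs)            ≡⟨ length-++ (f x) ⟩
  length (f x) + length (concatMap f xs)    ≤⟨ +-mono-≤ (bound x) (length-concatMap-≤-sum f c k bound xs) ⟩
  c * k x + c * sum (map k xs)              ≡⟨ *-distribˡ-+ c (k x) (sum (map k xs)) ⟨
  c * (k x + sum (map k xs))                ∎
  where open ≤-Reasoning

≤-foldr-⊔ : {A : Set} (f : A → ℕ) {x : A} {xs : List A} → x ∈ xs → f x ≤ foldr _⊔_ 0 (map f xs)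
≤-foldr-⊔ f (here refl) = m≤m⊔n _ _
≤-foldr-⊔ f {xs = y ∷ _} (there p) = ≤-trans (≤-foldr-⊔ f p) (m≤n⊔m (f y) _)

∈⇒≢[] : {A : Set} {x : A} {xs : List A} → x ∈ xs → xs ≢ []
∈⇒≢[] (here _) ()
∈⇒≢[] (there _) ()

∈-if⁺ : {A : Set} {x : A} {xs : List A} {b : Bool} → T b → x ∈ xs → x ∈ (if b then xs else [])
∈-if⁺ {b = true} _ p = p

∈-if⁻ : {A : Set} {x : A} {xs : List A} (b : Bool) → x ∈ (if b then xs else []) → T b × x ∈ xs
∈-if⁻ true p = tt , p

ifNonEmpty : {A B : Set} → List A → B → List B
ifNonEmpty [] x = []
ifNonEmpty (_ ∷ _) x = x ∷ []

ifEmpty : {A B : Set} → List A → B → List B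
ifEmpty [] x = x ∷ []
ifEmpty (_ ∷ _) x = []

∈-ifNonEmpty⁺ : {A B : Set} {l : List A} {x : B} → l ≢ [] → x ∈ ifNonEmpty l x
∈-ifNonEmpty⁺ {l = []} l≢[] = ⊥-elim (l≢[] refl)
∈-ifNonEmpty⁺ {l = _ ∷ _} _ = here refl

∈-ifNonEmpty⁻ : {A B : Set} {l : List A} {x y : B} → y ∈ ifNonEmpty l x → y ≡ x × l ≢ []
∈-ifNonEmpty⁻ {l = _ ∷ _} (here refl) = refl , λ ()

∈-ifEmpty⁺ : {A B : Set} {l : List A} {x : B} → l ≡ [] → x ∈ ifEmpty l x
∈-ifEmpty⁺ refl = here refl

∈-ifEmpty⁻ : {A B : Set} {l : List A} {x y : B} → y ∈ ifEmpty l x → y ≡ x × l ≡ []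
∈-ifEmpty⁻ {l = []} (here refl) = refl , refl

length-ifNonEmpty : {A B : Set} (l : List A) (x : B) → length (ifNonEmpty l x) ≤ length l
length-ifNonEmpty [] x = z≤n
length-ifNonEmpty (_ ∷ _) x = s≤s z≤n

length-ifEmpty : {A B : Set} (l : List A) (x : B) → length (ifEmpty l x) ≤ 1
length-ifEmpty [] x = s≤s z≤n
length-ifEmpty (_ ∷ _) x = z≤n

module _ {T : Tree} where
  open Tree T

  walk-++ : ∀ {P s s' s''} → WalkIn P s s' → WalkIn P s' s'' → WalkIn P s s''
  walk-++ (here p) w = w
  walk-++ (step p a w₁) w = step p a (walk-++ w₁ w)

  walk-mono : ∀ {P Q : Node → Set} {s s'} → (∀ {x} → P x → Q x) → WalkIn P s s' → WalkIn Q s s'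
  walk-mono P⊆Q (here p) = here (P⊆Q p)
  walk-mono P⊆Q (step p a w) = step (P⊆Q p) a (walk-mono P⊆Q w)

-- The new occurrence set of a is the union of the subtrees of its owners;
-- if one bag h contains all owners of a, this union is connected.

module Expansion {V U : Set} (T : Tree) (B : Tree.Node T → List V) (f : V → List U) where
  open Tree T

  expand : Node → List U
  expand s = concatMap f (B s)

  ∈-expand⁺ : ∀ {a s v} → v ∈ B s → a ∈ f v → a ∈ expand s
  ∈-expand⁺ v∈B a∈f = ∈-concatMap⁺ f (lose v∈B a∈f)

  ∈-expand⁻ : ∀ {a s} → a ∈ expand s → ∃[ v ] (v ∈ B s × a ∈ f v)
  ∈-expand⁻ {s = s} p = find (∈-concatMap⁻ f {xs = B s} p)

  expand-connected : (∀ v → ConnectedIn (λ s → v ∈ B s))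
    → (a : U) (h : Node) → (∀ {v} → a ∈ f v → v ∈ B h) → ConnectedIn (λ s → a ∈ expand s)
  expand-connected conn a h hub s s' a∈s a∈s' =
    let (v , v∈s , a∈fv) = ∈-expand⁻ a∈s
        (v' , v'∈s' , a∈fv') = ∈-expand⁻ a∈s'
    in walk-++ (walk-mono (λ q → ∈-expand⁺ q a∈fv) (conn v s h v∈s (hub a∈fv)))
               (walk-mono (λ q → ∈-expand⁺ q a∈fv') (conn v' h s' (hub a∈fv') v'∈s'))

  expand-length : (c : ℕ) → (∀ v → length (f v) ≤ c) → ∀ s → length (expand s) ≤ length (B s) * c
  expand-length c bound s = length-concatMap-≤ f c bound (B s)

-- Attaching m leaves to the root of a tree T.  The nodes of the extended
-- tree are Fin (suc k + m): the old nodes s ↦ s ↑ˡ m keep their parents,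
-- the leaves suc k ↑ʳ j hang below the root.

module LeafExtension (T : Tree) (m : ℕ) where
  private module T = Tree T
  open T using (k)

  old : T.Node → Fin (suc k + m)
  old s = s ↑ˡ m

  leaf : Fin m → Fin (suc k + m)
  leaf j = suc k ↑ʳ j

  parent⁺ : Fin (k + m) → Fin (suc (k + m))
  parent⁺ x = [ (λ i → old (T.parent i)) , (λ _ → fzero) ]′ (splitAt k x)

  parent⁺< : ∀ x → toℕ (parent⁺ x) ≤ toℕ x
  parent⁺< x with splitAt k x in eq
  ... | inj₂ _ = z≤n
  ... | inj₁ i = begin
    toℕ (T.parent i ↑ˡ m)  ≡⟨ toℕ-↑ˡ (T.parent i) m ⟩
    toℕ (T.parent i)       ≤⟨ T.parent< i ⟩
    toℕ i                  ≡⟨ toℕ-↑ˡ i m ⟨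
    toℕ (i ↑ˡ m)           ≡⟨ cong toℕ (splitAt⁻¹-↑ˡ eq) ⟩
    toℕ x                  ∎
    where open ≤-Reasoning

  extended : Tree
  extended = record { k = k + m ; parent = parent⁺ ; parent< = parent⁺< }

  private module X = Tree extended

  data View : X.Node → Set where
    oldNode  : (s : T.Node) → View (old s)
    leafNode : (j : Fin m) → View (leaf j)

  view : ∀ x → View x
  view x with splitAt (suc k) x in eq
  ... | inj₁ s = subst View (splitAt⁻¹-↑ˡ eq) (oldNode s)
  ... | inj₂ j = subst View (splitAt⁻¹-↑ʳ eq) (leafNode j)

  parent⁺-old : ∀ i → parent⁺ (i ↑ˡ m) ≡ old (T.parent i)
  parent⁺-old i = cong [ (λ i → old (T.parent i)) , (λ _ → fzero) ]′ (splitAt-↑ˡ k i m)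

  old-adj : ∀ {s s'} → T.Adj s s' → X.Adj (old s) (old s')
  old-adj (inj₁ (i , refl , refl)) = inj₁ (i ↑ˡ m , refl , sym (parent⁺-old i))
  old-adj (inj₂ (i , refl , refl)) = inj₂ (i ↑ˡ m , refl , sym (parent⁺-old i))

  walk-old : ∀ {P : T.Node → Set} {Q : X.Node → Set} {s s'}
    → (∀ {x} → P x → Q (old x)) → T.WalkIn P s s' → X.WalkIn Q (old s) (old s')
  walk-old P⇒Q (T.here p) = X.here (P⇒Q p)
  walk-old P⇒Q (T.step p a w) = X.step (P⇒Q p) (old-adj a) (walk-old P⇒Q w)

  module Glue {U : Set} (B : T.Node → List U) (L : Fin m → List U) where

    bag⁺ : X.Node → List U
    bag⁺ x = [ B , L ]′ (splitAt (suc k) x)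

    bag⁺-old : ∀ s → bag⁺ (old s) ≡ B s
    bag⁺-old s = cong [ B , L ]′ (splitAt-↑ˡ (suc k) s m)

    bag⁺-leaf : ∀ j → bag⁺ (leaf j) ≡ L j
    bag⁺-leaf j = cong [ B , L ]′ (splitAt-↑ʳ (suc k) m j)

    ∈-old⁺ : ∀ {a s} → a ∈ B s → a ∈ bag⁺ (old s)
    ∈-old⁺ {a} {s} = subst (a ∈_) (sym (bag⁺-old s))

    ∈-old⁻ : ∀ {a s} → a ∈ bag⁺ (old s) → a ∈ B s
    ∈-old⁻ {a} {s} = subst (a ∈_) (bag⁺-old s)

    ∈-leaf⁺ : ∀ {a j} → a ∈ L j → a ∈ bag⁺ (leaf j)
    ∈-leaf⁺ {a} {j} = subst (a ∈_) (sym (bag⁺-leaf j))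

    ∈-leaf⁻ : ∀ {a j} → a ∈ bag⁺ (leaf j) → a ∈ L j
    ∈-leaf⁻ {a} {j} = subst (a ∈_) (bag⁺-leaf j)

    connected-old : (a : U) → (∀ j → a ∉ L j) → T.ConnectedIn (λ s → a ∈ B s)
      → X.ConnectedIn (λ x → a ∈ bag⁺ x)
    connected-old a noLeaf conn x y a∈x a∈y with view x | view y
    ... | leafNode j | _ = ⊥-elim (noLeaf j (∈-leaf⁻ a∈x))
    ... | oldNode _ | leafNode j = ⊥-elim (noLeaf j (∈-leaf⁻ a∈y))
    ... | oldNode s | oldNode s' = walk-old ∈-old⁺ (conn s s' (∈-old⁻ a∈x) (∈-old⁻ a∈y))

    connected-leaf : (a : U) (j : Fin m) → (∀ s → a ∉ B s) → (∀ j' → a ∈ L j' → j' ≡ j)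
      → X.ConnectedIn (λ x → a ∈ bag⁺ x)
    connected-leaf a j noOld onlyAt-j x y a∈x a∈y with view x | view y
    ... | oldNode s | _ = ⊥-elim (noOld s (∈-old⁻ a∈x))
    ... | leafNode _ | oldNode s = ⊥-elim (noOld s (∈-old⁻ a∈y))
    ... | leafNode j₁ | leafNode j₂
      with onlyAt-j j₁ (∈-leaf⁻ a∈x) | onlyAt-j j₂ (∈-leaf⁻ a∈y)
    ... | refl | refl = X.here a∈x

module Ownership (TG : TemporalGraph) where
  open TemporalGraph TG

  vertex : Fin n → Univ
  vertex = inj₁

  edge : Fin m → Univ
  edge e = inj₂ (inj₁ e)

  timeEdge : (e : Fin m) (t : ℕ) → t ∈ lab e → Univ
  timeEdge e t p = inj₂ (inj₂ (e , t , p))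

  block : Fin m → List Univ
  block e = ifNonEmpty (lab e) (edge e) ++ mapWith∈ (lab e) (λ {t} → timeEdge e t)

  owned : Fin n → List Univ
  owned v = vertex v ∷ concatMap (λ e → if incident? v e then block e else []) (allFin m)

  -- An unlabelled edge owned by nobody gets a bag of its own.
  spare : Fin m → List Univ
  spare e = ifEmpty (lab e) (edge e)

  InBlock : Fin m → Univ → Set
  InBlock e (inj₁ _) = ⊥
  InBlock e (inj₂ (inj₁ e')) = e' ≡ e × lab e ≢ []
  InBlock e (inj₂ (inj₂ (e' , _))) = e' ≡ e

  OwnedBy : Fin n → Univ → Set
  OwnedBy v a = a ≡ vertex v ⊎ ∃[ e ] (Incident v e × InBlock e a)

  ∈-block⁺ : ∀ {e} a → InBlock e a → a ∈ block e
  ∈-block⁺ {e} (inj₂ (inj₁ _)) (refl , labelled) = ∈-++⁺ˡ (∈-ifNonEmpty⁺ labelled)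
  ∈-block⁺ {e} (inj₂ (inj₂ (_ , t , p))) refl =
    ∈-++⁺ʳ (ifNonEmpty (lab e) (edge e)) (mapWith∈⁺ (λ {t} → timeEdge e t) (t , p , refl))

  ∈-block⁻ : ∀ {e a} → a ∈ block e → InBlock e a
  ∈-block⁻ {e} p with ∈-++⁻ (ifNonEmpty (lab e) (edge e)) p
  ... | inj₁ q with ∈-ifNonEmpty⁻ q
  ...   | refl , labelled = refl , labelled
  ∈-block⁻ {e} p | inj₂ q with mapWith∈⁻ (lab e) (λ {t} → timeEdge e t) q
  ...   | _ , _ , refl = refl

  ∈-owned⁺ : ∀ {v} a → OwnedBy v a → a ∈ owned v
  ∈-owned⁺ a (inj₁ refl) = here refl
  ∈-owned⁺ a (inj₂ (e , inc , b)) =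
    there (∈-concatMap⁺ _ (lose (∈-allFin e) (∈-if⁺ (fromWitness inc) (∈-block⁺ a b))))

  ∈-owned⁻ : ∀ {v a} → a ∈ owned v → OwnedBy v a
  ∈-owned⁻ (here refl) = inj₁ refl
  ∈-owned⁻ {v} (there p) with find (∈-concatMap⁻ _ {xs = allFin m} p)
  ... | e , _ , q with ∈-if⁻ (incident? v e) q
  ...   | inc , b = inj₂ (e , toWitness inc , ∈-block⁻ b)

  anchor : Fin m ⊎ TimeEdge → Fin m
  anchor (inj₁ e) = e
  anchor (inj₂ (e , _)) = e

  owner-incident : ∀ {v} x → OwnedBy v (inj₂ x) → Incident v (anchor x)
  owner-incident (inj₁ _) (inj₂ (_ , inc , refl , _)) = inc
  owner-incident (inj₂ _) (inj₂ (_ , inc , refl)) = inc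

  length-block : ∀ e → length (block e) ≤ 2 * length (lab e)
  length-block e = begin
    length (block e)                                  ≡⟨ length-++ (ifNonEmpty (lab e) (edge e)) ⟩
    length (ifNonEmpty (lab e) (edge e)) + length ts  ≤⟨ +-mono-≤ (length-ifNonEmpty (lab e) (edge e))
                                                            (≤-reflexive (length-mapWith∈ (setoid ℕ) (lab e))) ⟩
    length (lab e) + length (lab e)                   ≡⟨ cong (length (lab e) +_) (+-identityʳ (length (lab e))) ⟨
    2 * length (lab e)                                ∎
    where open ≤-Reasoning
          ts = mapWith∈ (lab e) (λ {t} → timeEdge e t)

  length-owned : ∀ v → length (owned v) ≤ 2 * Δ + 1
  length-owned v = begin
    suc (length (concatMap incidentBlock (allFin m)))  ≤⟨ s≤s (length-concatMap-≤-sum incidentBlock 2 _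
                                                             length-incidentBlock (allFin m)) ⟩
    suc (2 * tdeg v)                                   ≤⟨ s≤s (*-monoʳ-≤ 2 (≤-foldr-⊔ tdeg (∈-allFin v))) ⟩
    suc (2 * Δ)                                        ≡⟨ +-comm 1 (2 * Δ) ⟩
    2 * Δ + 1                                          ∎
    where open ≤-Reasoning
          incidentBlock : Fin m → List Univ
          incidentBlock e = if incident? v e then block e else []
          length-incidentBlock : ∀ e → length (incidentBlock e)
                                     ≤ 2 * (if incident? v e then length (lab e) else 0)
          length-incidentBlock e with incident? v e
          ... | true = length-block e
          ... | false = z≤n

module TemporalDecomposition (TG : TemporalGraph) (w : ℕ)
    (D : TwPlusOne≤ (graphStructure (TemporalGraph.G TG)) w) where
  open TemporalGraph TG
  open Ownership TG
  open TreeDecomposition (proj₁ D)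
  open Expansion tree bag owned
  open LeafExtension tree m
  open Glue expand spare

  edgeBag : ∀ e → ∃[ h ] (∀ {v} → Incident v e → v ∈ bag h)
  edgeBag e with covers tt (proj₁ (ends e)) (proj₂ (ends e)) (e , refl)
  ... | h , p₁ , p₂ = h , λ { (inj₁ refl) → p₁ ; (inj₂ refl) → p₂ }

  ownersBag : ∀ a → ∃[ h ] (∀ {v} → OwnedBy v a → v ∈ bag h)
  ownersBag (inj₁ u) with nonempty u
  ... | h , u∈h = h , λ { (inj₁ refl) → u∈h ; (inj₂ (_ , _ , ())) }
  ownersBag (inj₂ x) with edgeBag (anchor x)
  ... | h , incident∈h = h , λ owner → incident∈h (owner-incident x owner)

  occurrences-connected : ∀ a → Tree.ConnectedIn tree (λ s → a ∈ expand s)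
  occurrences-connected a with ownersBag a
  ... | h , owners∈h = expand-connected connected a h (λ a∈v → owners∈h (∈-owned⁻ a∈v))

  edgeNode : Fin m → Tree.Node extended
  edgeNode e = old (proj₁ (edgeBag e))

  ∈-edgeNode : ∀ {e} a → InBlock e a → a ∈ bag⁺ (edgeNode e)
  ∈-edgeNode {e} a inBlock = ∈-old⁺ (∈-expand⁺ (proj₂ (edgeBag e) (inj₁ refl))
                                               (∈-owned⁺ a (inj₂ (e , inj₁ refl , inBlock))))

  -- Unlabelled edges live in their own leaf only; all other elements live in
  -- old bags only, where they occupy a subtree.
  connected⁺ : ∀ a → Tree.ConnectedIn extended (λ x → a ∈ bag⁺ x)
  connected⁺ (inj₂ (inj₁ e)) with ≡-dec _≟_ (lab e) []
  ... | yes unlabelled = connected-leaf (edge e) e notOwned onlySpare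
    where notOwned : ∀ s → edge e ∉ expand s
          notOwned s p with ∈-expand⁻ p
          ... | _ , _ , q with ∈-owned⁻ q
          ...   | inj₂ (_ , _ , refl , labelled) = labelled unlabelled
          onlySpare : ∀ j → edge e ∈ spare j → j ≡ e
          onlySpare j p with ∈-ifEmpty⁻ p
          ... | refl , _ = refl
  ... | no labelled = connected-old (edge e) notSpare (occurrences-connected (edge e))
    where notSpare : ∀ j → edge e ∉ spare j
          notSpare j p with ∈-ifEmpty⁻ p
          ... | refl , unlabelled = labelled unlabelled
  connected⁺ (inj₁ u) = connected-old (inj₁ u) notSpare (occurrences-connected (inj₁ u))
    where notSpare : ∀ j → inj₁ u ∉ spare j
          notSpare j p with ∈-ifEmpty⁻ p
          ... | () , _
  connected⁺ (inj₂ (inj₂ te)) = connected-old (inj₂ (inj₂ te)) notSpare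
                                              (occurrences-connected (inj₂ (inj₂ te)))
    where notSpare : ∀ j → inj₂ (inj₂ te) ∉ spare j
          notSpare j p with ∈-ifEmpty⁻ p
          ... | () , _

  nonempty⁺ : ∀ a → ∃[ x ] (a ∈ bag⁺ x)
  nonempty⁺ (inj₁ u) with nonempty u
  ... | s , u∈s = old s , ∈-old⁺ (∈-expand⁺ u∈s (∈-owned⁺ (inj₁ u) (inj₁ refl)))
  nonempty⁺ (inj₂ (inj₁ e)) with ≡-dec _≟_ (lab e) []
  ... | yes unlabelled = leaf e , ∈-leaf⁺ (∈-ifEmpty⁺ unlabelled)
  ... | no labelled = edgeNode e , ∈-edgeNode (edge e) (refl , labelled)
  nonempty⁺ (inj₂ (inj₂ (e , t , p))) = edgeNode e , ∈-edgeNode (timeEdge e t p) refl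

  -- 𝓡-related time-edges share a vertex owning both; 𝓛 pairs lie in a block.
  covers⁺ : ∀ r a b → Structure.rel (𝓐 TG) r a b → ∃[ x ] (a ∈ bag⁺ x × b ∈ bag⁺ x)
  covers⁺ true (inj₂ (inj₂ (e₁ , t₁ , p₁))) (inj₂ (inj₂ (e₂ , t₂ , p₂))) ((v , inc₁ , inc₂) , _)
    with nonempty v
  ... | s , v∈s = old s , owned-at (inj₂ (e₁ , inc₁ , refl)) , owned-at (inj₂ (e₂ , inc₂ , refl))
    where owned-at : ∀ {c} → OwnedBy v c → c ∈ bag⁺ (old s)
          owned-at {c} o = ∈-old⁺ (∈-expand⁺ v∈s (∈-owned⁺ c o))
  covers⁺ false (inj₂ (inj₁ e)) (inj₂ (inj₂ (.e , t , p))) refl =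
    edgeNode e , ∈-edgeNode (edge e) (refl , ∈⇒≢[] p) , ∈-edgeNode (timeEdge e t p) refl
  covers⁺ true (inj₁ _) _ ()
  covers⁺ true (inj₂ (inj₁ _)) _ ()
  covers⁺ true (inj₂ (inj₂ _)) (inj₁ _) ()
  covers⁺ true (inj₂ (inj₂ _)) (inj₂ (inj₁ _)) ()
  covers⁺ false (inj₁ _) _ ()
  covers⁺ false (inj₂ (inj₂ _)) _ ()
  covers⁺ false (inj₂ (inj₁ _)) (inj₁ _) ()
  covers⁺ false (inj₂ (inj₁ _)) (inj₂ (inj₁ _)) ()

  -- A graph with an edge has a nonempty bag, so w ≥ 1 whenever a leaf exists.
  width-positive : Fin m → 1 ≤ w
  width-positive e with nonempty (proj₁ (ends e))
  ... | s , p = ≤-trans (∈-length p) (proj₂ D s)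

  length-bag⁺ : ∀ x → length (bag⁺ x) ≤ (2 * Δ + 1) * w
  length-bag⁺ x with view x
  ... | oldNode s rewrite bag⁺-old s = begin
    length (expand s)             ≤⟨ expand-length (2 * Δ + 1) length-owned s ⟩
    length (bag s) * (2 * Δ + 1)  ≤⟨ *-monoˡ-≤ (2 * Δ + 1) (proj₂ D s) ⟩
    w * (2 * Δ + 1)               ≡⟨ *-comm w (2 * Δ + 1) ⟩
    (2 * Δ + 1) * w               ∎
    where open ≤-Reasoning
  ... | leafNode j rewrite bag⁺-leaf j =
    ≤-trans (length-ifEmpty (lab j) (edge j)) (*-mono-≤ (m≤n+m 1 (2 * Δ)) (width-positive j))

  decomposition : TwPlusOne≤ (𝓐 TG) ((2 * Δ + 1) * w)
  decomposition = record { tree = extended ; bag = bag⁺ ; nonempty = nonempty⁺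
                         ; connected = connected⁺ ; covers = covers⁺ }
                , length-bag⁺

lemma7 : (TG : TemporalGraph) (w : ℕ)
    → TwPlusOne≤ (graphStructure (TemporalGraph.G TG)) w
    → TwPlusOne≤ (𝓐 TG) ((2 * TemporalGraph.Δ TG + 1) * w)
lemma7 TG w D = TemporalDecomposition.decomposition TG w D
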